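{- Let $\varphi(x_1,\ldots,x_n)$ be an expression and let $a_1,\ldots,a_n\in \mathrm{M}$ be a valuation with $|\varphi(a_1,\ldots,a_n)| = |a_i| = b$ computed over $\mathrm{M}$, where the variables are indexed so that $$|a_1|\le\cdots\le|a_{i-1}|<|a_i|=\cdots=|a_{i+r}|<|a_{i+r+1}|\le\cdots\le|a_n|$$ for some $r\ge 0$. Then: (1) $\varphi(a_1,\ldots,a_n)=\varphi(a_1',\ldots,a_{i-1}',a_i,\ldots,a_n)$ for any $a_1',\ldots,a_{i-1}'\in\mathrm{M}$ with $|a_j'|<b$ for all $j<i$ (in particular, changes of sign are allowed); (2) $\varphi(a_1,\ldots,a_n)=\varphi(a_1,\ldots,a_{i+r},a_{i+r+1}',\ldots,a_n')$ for any $a_{i+r+1}',\ldots,a_n'\in\mathrm{M}$ such that, for each $j>i+r$, $|a_j'|>b$ and $a_j'$ has the same sign as $a_j$.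
   Context: $\mathrm{M}$ denotes the set $\widehat{\mathbb{Z}}=(\mathbb{Z}\setminus\{0\})\cup\{ -\infty,\infty\}$, totally ordered in the usual way, with $a\land b=\min(a,b)$, $a\lor b=\max(a,b)$ and $\lnot a=-a$ (with $-(\pm\infty)=\mp\infty$, $|\pm\infty|=\infty$). An expression is a propositional formula built from variables using only $\land,\lor,\lnot$ (no constants); $\varphi(a_1,\ldots,a_n)$ denotes its value in $\mathrm{M}$ when $x_j$ is assigned $a_j$. -}

module Defs where

open import Data.Nat using (ℕ; zero; suc; _≤_; _<_; _+_; _≤ᵇ_)
open import Data.Bool using (Bool; true; false; if_then_else_)
open import Data.Fin using (Fin; toℕ)

-- The chain M = (ℤ ∖ {0}) ∪ {-∞, ∞}.
--   neg k  denotes the integer -(k+1),  pos k  denotes k+1.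
data M : Set where
  -∞  : M
  neg : ℕ → M
  pos : ℕ → M
  ∞   : M

_≤M_ : M → M → Bool
-∞    ≤M _     = true
_     ≤M ∞     = true
∞     ≤M _     = false
_     ≤M -∞    = false
neg m ≤M neg n = n ≤ᵇ m
neg _ ≤M pos _ = true
pos _ ≤M neg _ = false
pos m ≤M pos n = m ≤ᵇ n

_⊓_ : M → M → M
a ⊓ b = if a ≤M b then a else b

_⊔_ : M → M → M
a ⊔ b = if a ≤M b then b else a

negM : M → M
negM -∞      = ∞
negM (neg k) = pos k
negM (pos k) = neg k
negM ∞       = -∞

-- absolute values live in {1,2,3,...} ∪ {∞}; fin k denotes k+1
data Abs : Set where
  fin : ℕ → Abs
  inf : Abs

∣_∣ : M → Abs
∣ -∞ ∣    = inf
∣ neg k ∣ = fin k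
∣ pos k ∣ = fin k
∣ ∞ ∣     = inf

data _<A_ : Abs → Abs → Set where
  fin<fin : ∀ {m n} → m < n → fin m <A fin n
  fin<inf : ∀ {m} → fin m <A inf

data _≤A_ : Abs → Abs → Set where
  fin≤fin : ∀ {m n} → m ≤ n → fin m ≤A fin n
  ≤inf    : ∀ {x} → x ≤A inf

data Sign : Set where
  minus plus : Sign

sign : M → Sign
sign -∞      = minus
sign (neg _) = minus
sign (pos _) = plus
sign ∞       = plus

data Expr (n : ℕ) : Set where
  var   : Fin n → Expr n
  _∧ₑ_  : Expr n → Expr n → Expr n
  _∨ₑ_  : Expr n → Expr n → Expr n
  ¬ₑ_   : Expr n → Expr n

eval : ∀ {n} → Expr n → (Fin n → M) → M
eval (var j)   a = a j
eval (φ ∧ₑ ψ)  a = eval φ a ⊓ eval ψ a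
eval (φ ∨ₑ ψ)  a = eval φ a ⊔ eval ψ a
eval (¬ₑ φ)    a = negM (eval φ a)

module Submission where

-- A relation ∼ on M whose classes are intervals of the chain, and which negation maps
-- to itself, is a congruence for ⊓, ⊔ and ¬; so φ(a) ∼ φ(a′) whenever a j ∼ a′ j for
-- all j. Both parts use such a relation: for (1), "equal, or both of absolute value
-- < b"; for (2), "equal, or both of absolute value > b with the same sign". In each
-- case the class of an element of absolute value exactly b is a singleton, and
-- |φ(a)| = b, so φ(a′) = φ(a).

open import Defs
open import Data.Nat using (ℕ; _≤_; _<_; _+_; _≤ᵇ_; _<?_)
open import Data.Nat.Properties using (≤ᵇ⇒≤; ≤⇒≤ᵇ; ≤-antisym; ≤-total; <-≤-trans; ≤-<-trans; <-irrefl; ≮⇒≥)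
open import Data.Fin using (Fin; toℕ)
open import Data.Product using (_×_; _,_; proj₂)
open import Data.Sum using (_⊎_; inj₁; inj₂)
open import Data.Bool using (true; false; T)
open import Data.Unit using (tt)
open import Data.Empty using (⊥-elim)
open import Relation.Nullary using (¬_; yes; no)
open import Relation.Binary.PropositionalEquality using (_≡_; refl; sym; trans; cong; subst)

_≼_ : M → M → Set
x ≼ y = T (x ≤M y)

≤ᵇ-total : ∀ m n → T (m ≤ᵇ n) ⊎ T (n ≤ᵇ m)
≤ᵇ-total m n with ≤-total m n
... | inj₁ m≤n = inj₁ (≤⇒≤ᵇ m≤n)
... | inj₂ n≤m = inj₂ (≤⇒≤ᵇ n≤m)

≼-total : ∀ x y → x ≼ y ⊎ y ≼ x
≼-total -∞      _       = inj₁ tt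
≼-total (neg _) -∞      = inj₂ tt
≼-total (neg m) (neg n) = ≤ᵇ-total n m
≼-total (neg _) (pos _) = inj₁ tt
≼-total (neg _) ∞       = inj₁ tt
≼-total (pos _) -∞      = inj₂ tt
≼-total (pos _) (neg _) = inj₂ tt
≼-total (pos m) (pos n) = ≤ᵇ-total m n
≼-total (pos _) ∞       = inj₁ tt
≼-total ∞       ∞       = inj₁ tt
≼-total ∞       -∞      = inj₂ tt
≼-total ∞       (neg _) = inj₂ tt
≼-total ∞       (pos _) = inj₂ tt

≼-antisym : ∀ {x y} → x ≼ y → y ≼ x → x ≡ y
≼-antisym { -∞}    { -∞}    _   _   = refl
≼-antisym {∞}     {∞}     _   _   = refl
≼-antisym {neg m} {neg n} x≼y y≼x = cong neg (≤-antisym (≤ᵇ⇒≤ m n y≼x) (≤ᵇ⇒≤ n m x≼y))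
≼-antisym {pos m} {pos n} x≼y y≼x = cong pos (≤-antisym (≤ᵇ⇒≤ m n x≼y) (≤ᵇ⇒≤ n m y≼x))
≼-antisym { -∞}    {neg _} _ ()
≼-antisym { -∞}    {pos _} _ ()
≼-antisym { -∞}    {∞}     _ ()
≼-antisym {neg _} { -∞}    ()
≼-antisym {neg _} {pos _} _ ()
≼-antisym {neg _} {∞}     _ ()
≼-antisym {pos _} { -∞}    ()
≼-antisym {pos _} {neg _} ()
≼-antisym {pos _} {∞}     _ ()
≼-antisym {∞}     { -∞}    ()
≼-antisym {∞}     {neg _} ()
≼-antisym {∞}     {pos _} ()

⊓-cases : ∀ x y → (x ≼ y × x ⊓ y ≡ x) ⊎ (y ≼ x × x ⊓ y ≡ y)
⊓-cases x y with x ≤M y in eq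
... | true  = inj₁ (tt , refl)
... | false with ≼-total x y
...   | inj₁ x≼y = ⊥-elim (subst T eq x≼y)
...   | inj₂ y≼x = inj₂ (y≼x , refl)

⊔-cases : ∀ x y → (x ≼ y × x ⊔ y ≡ y) ⊎ (y ≼ x × x ⊔ y ≡ x)
⊔-cases x y with x ≤M y in eq
... | true  = inj₁ (tt , refl)
... | false with ≼-total x y
...   | inj₁ x≼y = ⊥-elim (subst T eq x≼y)
...   | inj₂ y≼x = inj₂ (y≼x , refl)

-- Q is the relation off the diagonal: its classes are the non-singleton classes of ∼.
module ConvexCongruence
  (Q : M → M → Set)
  (Q-sym : ∀ {x y} → Q x y → Q y x)
  (Q-trans : ∀ {x y z} → Q x y → Q y z → Q x z)
  (Q-convex : ∀ {x y z} → Q x y → x ≼ z → z ≼ y → Q x z)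
  (Q-negM : ∀ {x y} → Q x y → Q (negM x) (negM y))
  where

  _∼_ : M → M → Set
  x ∼ y = x ≡ y ⊎ Q x y

  ∼-sym : ∀ {x y} → x ∼ y → y ∼ x
  ∼-sym (inj₁ x≡y) = inj₁ (sym x≡y)
  ∼-sym (inj₂ q)   = inj₂ (Q-sym q)

  ∼-trans : ∀ {x y z} → x ∼ y → y ∼ z → x ∼ z
  ∼-trans (inj₁ refl) y∼z         = y∼z
  ∼-trans x∼y         (inj₁ refl) = x∼y
  ∼-trans (inj₂ p)    (inj₂ q)    = inj₂ (Q-trans p q)

  ∼-convex : ∀ {x y z} → x ∼ y → x ≼ z → z ≼ y → x ∼ z
  ∼-convex (inj₁ refl) x≼z z≼x = inj₁ (≼-antisym x≼z z≼x)
  ∼-convex (inj₂ q)    x≼z z≼y = inj₂ (Q-convex q x≼z z≼y)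

  negM-cong : ∀ {x y} → x ∼ y → negM x ∼ negM y
  negM-cong (inj₁ refl) = inj₁ refl
  negM-cong (inj₂ q)    = inj₂ (Q-negM q)

  -- The crossed case of both ⊓ and ⊔: c′ lies between a and a′, or a between c′ and c.
  ∼-cross : ∀ {a a′ c c′} → a ∼ a′ → c ∼ c′ → a ≼ c → c′ ≼ a′ → a ∼ c′
  ∼-cross {a} {c′ = c′} a∼a′ c∼c′ a≼c c′≼a′ with ≼-total a c′
  ... | inj₁ a≼c′ = ∼-convex a∼a′ a≼c′ c′≼a′
  ... | inj₂ c′≼a = ∼-sym (∼-convex (∼-sym c∼c′) c′≼a a≼c)

  ⊓-cong : ∀ {x x′ y y′} → x ∼ x′ → y ∼ y′ → (x ⊓ y) ∼ (x′ ⊓ y′)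
  ⊓-cong {x} {x′} {y} {y′} x∼x′ y∼y′ with ⊓-cases x y | ⊓-cases x′ y′
  ... | inj₁ (_ , e)   | inj₁ (_ , e′)     rewrite e | e′ = x∼x′
  ... | inj₁ (x≼y , e) | inj₂ (y′≼x′ , e′) rewrite e | e′ = ∼-cross x∼x′ y∼y′ x≼y y′≼x′
  ... | inj₂ (y≼x , e) | inj₁ (x′≼y′ , e′) rewrite e | e′ = ∼-cross y∼y′ x∼x′ y≼x x′≼y′
  ... | inj₂ (_ , e)   | inj₂ (_ , e′)     rewrite e | e′ = y∼y′

  ⊔-cong : ∀ {x x′ y y′} → x ∼ x′ → y ∼ y′ → (x ⊔ y) ∼ (x′ ⊔ y′)
  ⊔-cong {x} {x′} {y} {y′} x∼x′ y∼y′ with ⊔-cases x y | ⊔-cases x′ y′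
  ... | inj₁ (_ , e)   | inj₁ (_ , e′)     rewrite e | e′ = y∼y′
  ... | inj₁ (x≼y , e) | inj₂ (y′≼x′ , e′) rewrite e | e′ =
    ∼-trans y∼y′ (∼-trans (∼-sym (∼-cross x∼x′ y∼y′ x≼y y′≼x′)) x∼x′)
  ... | inj₂ (y≼x , e) | inj₁ (x′≼y′ , e′) rewrite e | e′ =
    ∼-trans x∼x′ (∼-trans (∼-sym (∼-cross y∼y′ x∼x′ y≼x x′≼y′)) y∼y′)
  ... | inj₂ (_ , e)   | inj₂ (_ , e′)     rewrite e | e′ = x∼x′

  eval-cong : ∀ {n} (φ : Expr n) {a a′ : Fin n → M} →
    (∀ j → a j ∼ a′ j) → eval φ a ∼ eval φ a′
  eval-cong (var j)  a∼a′ = a∼a′ j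
  eval-cong (φ ∧ₑ ψ) a∼a′ = ⊓-cong (eval-cong φ a∼a′) (eval-cong ψ a∼a′)
  eval-cong (φ ∨ₑ ψ) a∼a′ = ⊔-cong (eval-cong φ a∼a′) (eval-cong ψ a∼a′)
  eval-cong (¬ₑ φ)   a∼a′ = negM-cong (eval-cong φ a∼a′)

  eval-≡-of-isolated : ∀ {n} (φ : Expr n) {a a′ : Fin n → M} →
    (∀ {y} → ¬ Q (eval φ a) y) → (∀ j → a j ∼ a′ j) → eval φ a ≡ eval φ a′
  eval-≡-of-isolated φ isolated a∼a′ with eval-cong φ a∼a′
  ... | inj₁ eq = eq
  ... | inj₂ q  = ⊥-elim (isolated q)

<A-irrefl : ∀ {x} → ¬ x <A x
<A-irrefl (fin<fin m<m) = <-irrefl refl m<m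

≤A-<A-trans : ∀ {x y z} → x ≤A y → y <A z → x <A z
≤A-<A-trans (fin≤fin l≤m) (fin<fin m<n) = fin<fin (≤-<-trans l≤m m<n)
≤A-<A-trans (fin≤fin _)   fin<inf       = fin<inf

<A-≤A-trans : ∀ {x y z} → x <A y → y ≤A z → x <A z
<A-≤A-trans (fin<fin l<m) (fin≤fin m≤n) = fin<fin (<-≤-trans l<m m≤n)
<A-≤A-trans (fin<fin _)   ≤inf          = fin<inf
<A-≤A-trans fin<inf       ≤inf          = fin<inf

≼-plus : ∀ {x y} → x ≼ y → sign x ≡ plus → sign y ≡ plus × ∣ x ∣ ≤A ∣ y ∣
≼-plus {pos m} {pos n} x≼y _ = refl , fin≤fin (≤ᵇ⇒≤ m n x≼y)
≼-plus {pos _} {∞}     _   _ = refl , ≤inf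
≼-plus {∞}     {∞}     _   _ = refl , ≤inf
≼-plus {pos _} { -∞}    ()
≼-plus {pos _} {neg _} ()
≼-plus {∞}     { -∞}    ()
≼-plus {∞}     {neg _} ()
≼-plus {∞}     {pos _} ()
≼-plus { -∞}    _ ()
≼-plus {neg _} _ ()

≼-minus : ∀ {x y} → x ≼ y → sign y ≡ minus → sign x ≡ minus × ∣ y ∣ ≤A ∣ x ∣
≼-minus {neg m} {neg n} x≼y _ = refl , fin≤fin (≤ᵇ⇒≤ n m x≼y)
≼-minus { -∞}    {neg _} _   _ = refl , ≤inf
≼-minus { -∞}    { -∞}    _   _ = refl , ≤inf
≼-minus {pos _} {neg _} ()
≼-minus {∞}     {neg _} ()
≼-minus {neg _} { -∞}    ()
≼-minus {pos _} { -∞}    ()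
≼-minus {∞}     { -∞}    ()
≼-minus {_}     {pos _} _ ()
≼-minus {_}     {∞}     _ ()

∣negM∣ : ∀ x → ∣ negM x ∣ ≡ ∣ x ∣
∣negM∣ -∞      = refl
∣negM∣ (neg _) = refl
∣negM∣ (pos _) = refl
∣negM∣ ∞       = refl

opposite : Sign → Sign
opposite minus = plus
opposite plus  = minus

sign-negM : ∀ x → sign (negM x) ≡ opposite (sign x)
sign-negM -∞      = refl
sign-negM (neg _) = refl
sign-negM (pos _) = refl
sign-negM ∞       = refl

Small : Abs → M → M → Set
Small b x y = ∣ x ∣ <A b × ∣ y ∣ <A b

Small-convex : ∀ {b x y z} → Small b x y → x ≼ z → z ≼ y → Small b x z
Small-convex {z = z} (∣x∣<b , ∣y∣<b) x≼z z≼y with sign z in sz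
... | minus = ∣x∣<b , ≤A-<A-trans (proj₂ (≼-minus x≼z sz)) ∣x∣<b
... | plus  = ∣x∣<b , ≤A-<A-trans (proj₂ (≼-plus z≼y sz)) ∣y∣<b

Small-negM : ∀ {b x y} → Small b x y → Small b (negM x) (negM y)
Small-negM {b} {x} {y} (∣x∣<b , ∣y∣<b) =
  subst (_<A b) (sym (∣negM∣ x)) ∣x∣<b , subst (_<A b) (sym (∣negM∣ y)) ∣y∣<b

module SmallCongruence (b : Abs) = ConvexCongruence (Small b)
  (λ (∣x∣<b , ∣y∣<b) → ∣y∣<b , ∣x∣<b)
  (λ (∣x∣<b , _) (_ , ∣z∣<b) → ∣x∣<b , ∣z∣<b)
  Small-convex
  Small-negM

Large : Abs → M → M → Set
Large b x y = b <A ∣ x ∣ × b <A ∣ y ∣ × sign x ≡ sign y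

Large-convex : ∀ {b x y z} → Large b x y → x ≼ z → z ≼ y → Large b x z
Large-convex {x = x} (b<∣x∣ , b<∣y∣ , sx≡sy) x≼z z≼y with sign x in sx
... | plus  = let sz , ∣x∣≤∣z∣ = ≼-plus x≼z sx
              in b<∣x∣ , <A-≤A-trans b<∣x∣ ∣x∣≤∣z∣ , sym sz
... | minus = let sz , ∣y∣≤∣z∣ = ≼-minus z≼y (sym sx≡sy)
              in b<∣x∣ , <A-≤A-trans b<∣y∣ ∣y∣≤∣z∣ , sym sz

Large-negM : ∀ {b x y} → Large b x y → Large b (negM x) (negM y)
Large-negM {b} {x} {y} (b<∣x∣ , b<∣y∣ , sx≡sy) =
  subst (b <A_) (sym (∣negM∣ x)) b<∣x∣ ,
  subst (b <A_) (sym (∣negM∣ y)) b<∣y∣ ,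
  trans (sign-negM x) (trans (cong opposite sx≡sy) (sym (sign-negM y)))

module LargeCongruence (b : Abs) = ConvexCongruence (Large b)
  (λ (b<∣x∣ , b<∣y∣ , sx≡sy) → b<∣y∣ , b<∣x∣ , sym sx≡sy)
  (λ (b<∣x∣ , _ , sx≡sy) (_ , b<∣z∣ , sy≡sz) → b<∣x∣ , b<∣z∣ , trans sx≡sy sy≡sz)
  Large-convex
  Large-negM

eval-stable-below : ∀ {n} (φ : Expr n) {a a′ : Fin n → M} {b : Abs} → ∣ eval φ a ∣ ≡ b →
  (∀ j → a j ≡ a′ j ⊎ Small b (a j) (a′ j)) → eval φ a ≡ eval φ a′
eval-stable-below φ refl = SmallCongruence.eval-≡-of-isolated _ φ (λ (b<b , _) → <A-irrefl b<b)

eval-stable-above : ∀ {n} (φ : Expr n) {a a′ : Fin n → M} {b : Abs} → ∣ eval φ a ∣ ≡ b →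
  (∀ j → a j ≡ a′ j ⊎ Large b (a j) (a′ j)) → eval φ a ≡ eval φ a′
eval-stable-above φ refl = LargeCongruence.eval-≡-of-isolated _ φ (λ (b<b , _) → <A-irrefl b<b)

theorem2 : ∀ (n : ℕ) (φ : Expr n) (a : Fin n → M) (i : Fin n) (r : ℕ) →
    toℕ i + r < n →
    (∀ j k → toℕ j ≤ toℕ k → ∣ a j ∣ ≤A ∣ a k ∣) →
    (∀ j → toℕ j < toℕ i → ∣ a j ∣ <A ∣ a i ∣) →
    (∀ j → toℕ i ≤ toℕ j → toℕ j ≤ toℕ i + r → ∣ a j ∣ ≡ ∣ a i ∣) →
    (∀ j → toℕ i + r < toℕ j → ∣ a i ∣ <A ∣ a j ∣) →
    ∣ eval φ a ∣ ≡ ∣ a i ∣ →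
    (∀ (a′ : Fin n → M) →
       (∀ j → toℕ j < toℕ i → ∣ a′ j ∣ <A ∣ a i ∣) →
       (∀ j → toℕ i ≤ toℕ j → a′ j ≡ a j) →
       eval φ a ≡ eval φ a′)
    ×
    (∀ (a′ : Fin n → M) →
       (∀ j → toℕ i + r < toℕ j → ∣ a i ∣ <A ∣ a′ j ∣ × sign (a′ j) ≡ sign (a j)) →
       (∀ j → toℕ j ≤ toℕ i + r → a′ j ≡ a j) →
       eval φ a ≡ eval φ a′)
theorem2 n φ a i r _ _ below _ above ∣φa∣≡b =
  (λ a′ small′ same → eval-stable-below φ ∣φa∣≡b (below-related a′ small′ same)) ,
  (λ a′ large′ same → eval-stable-above φ ∣φa∣≡b (above-related a′ large′ same))
  where
  below-related : ∀ a′ → (∀ j → toℕ j < toℕ i → ∣ a′ j ∣ <A ∣ a i ∣) → (∀ j → toℕ i ≤ toℕ j → a′ j ≡ a j) →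
    ∀ j → a j ≡ a′ j ⊎ Small ∣ a i ∣ (a j) (a′ j)
  below-related a′ small′ same j with toℕ j <? toℕ i
  ... | yes j<i = inj₂ (below j j<i , small′ j j<i)
  ... | no  j≮i = inj₁ (sym (same j (≮⇒≥ j≮i)))

  above-related : ∀ a′ → (∀ j → toℕ i + r < toℕ j → ∣ a i ∣ <A ∣ a′ j ∣ × sign (a′ j) ≡ sign (a j)) →
    (∀ j → toℕ j ≤ toℕ i + r → a′ j ≡ a j) → ∀ j → a j ≡ a′ j ⊎ Large ∣ a i ∣ (a j) (a′ j)
  above-related a′ large′ same j with toℕ i + r <? toℕ j
  ... | yes i+r<j = let b<∣a′j∣ , s≡ = large′ j i+r<j in inj₂ (above j i+r<j , b<∣a′j∣ , sym s≡)
  ... | no  i+r≮j = inj₁ (sym (same j (≮⇒≥ i+r≮j)))
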